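{- For every connected graph $G$, $\tau(G)\leq \left\lceil \frac{(\operatorname{dll}(G)+1)\,\operatorname{p}(G)}{2}\right\rceil$.
   Context: All graphs are finite and simple. For an integer $k\geq 0$, the $k$-daddy-longlegs $W^{(k)}$ is the tree with vertex set $\{r,u_1,\dots,u_k,v_1,\dots,v_k\}$ and edges $ru_i,u_iv_i$ for $i\in\{1,\dots,k\}$. $\operatorname{dll}(G)$ is the maximum $k\geq 0$ such that $W^{(k)}$ is a minor of $G$. The path number $\operatorname{p}(G)$ is the maximum $n\geq 0$ such that $G$ contains a path on $n$ vertices. $\tau(G)$ is the vertex cover number: the minimum size of a set $A\subseteq V(G)$ such that $V(G)\setminus A$ is independent. -}

module Defs where

open import Data.Nat using (ℕ; zero; suc; _≤_; _+_; _*_; ⌈_/2⌉)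
open import Data.Fin using (Fin; toℕ)
open import Data.Fin.Subset using (Subset; _∈_; ∣_∣)
open import Data.Product using (Σ; ∃; _×_; _,_)
open import Data.Sum using (_⊎_)
open import Data.Unit using (⊤)
open import Data.Empty using (⊥)
open import Relation.Nullary using (¬_)
open import Relation.Binary.PropositionalEquality using (_≡_; _≢_)
open import Function.Definitions using (Injective)

record Graph : Set₁ where
  field
    n      : ℕ
    E      : Fin n → Fin n → Set
    E-sym  : ∀ {x y} → E x y → E y x
    E-irr  : ∀ {x} → ¬ E x x
open Graph public

data WalkIn (G : Graph) (P : Fin (n G) → Set) : Fin (n G) → Fin (n G) → Set where
  here : ∀ {x} → P x → WalkIn G P x x
  step : ∀ {x y z} → P x → E G x y → WalkIn G P y z → WalkIn G P x z

Connected : Graph → Set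
Connected G = ∀ x y → WalkIn G (λ _ → ⊤) x y

record MinorModel (VH : Set) (EH : VH → VH → Set) (G : Graph) : Set₁ where
  field
    B         : VH → Fin (n G) → Set
    nonempty  : ∀ h → ∃ λ x → B h x
    connected : ∀ h x y → B h x → B h y → WalkIn G (B h) x y
    disjoint  : ∀ h h' x → h ≢ h' → B h x → B h' x → ⊥
    edges     : ∀ h h' → EH h h' → ∃ λ x → ∃ λ y → B h x × B h' y × E G x y

data DLLVertex (k : ℕ) : Set where
  r : DLLVertex k
  u : Fin k → DLLVertex k
  v : Fin k → DLLVertex k

data DLLEdge (k : ℕ) : DLLVertex k → DLLVertex k → Set where
  ru : ∀ i → DLLEdge k r (u i)
  ur : ∀ i → DLLEdge k (u i) r
  uv : ∀ i → DLLEdge k (u i) (v i)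
  vu : ∀ i → DLLEdge k (v i) (u i)

HasDLLMinor : Graph → ℕ → Set₁
HasDLLMinor G k = MinorModel (DLLVertex k) (DLLEdge k) G

IsDll : Graph → ℕ → Set₁
IsDll G k = HasDLLMinor G k × (∀ j → HasDLLMinor G j → j ≤ k)

record PathOn (G : Graph) (m : ℕ) : Set where
  field
    f     : Fin m → Fin (n G)
    inj   : Injective _≡_ _≡_ f
    adj   : ∀ (i j : Fin m) → toℕ j ≡ suc (toℕ i) → E G (f i) (f j)

IsPathNumber : Graph → ℕ → Set
IsPathNumber G m = PathOn G m × (∀ j → PathOn G j → j ≤ m)

IsVertexCover : (G : Graph) → Subset (n G) → Set
IsVertexCover G A = ∀ x y → E G x y → (x ∈ A) ⊎ (y ∈ A)

IsTau : Graph → ℕ → Set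
IsTau G t = (Σ (Subset (n G)) λ A → IsVertexCover G A × ∣ A ∣ ≡ t)
          × (∀ A → IsVertexCover G A → t ≤ ∣ A ∣)

{-# OPTIONS --safe #-}
-- If p ≤ 1 there are no edges. Otherwise write p = 2 + q and argue by induction on rooted
-- connected vertex sets S ∋ x. Split S at an edge x c into the part S₁ that c reaches in S − x
-- and the rest S′ ∋ x; every edge between the parts ends in x. Recursively each part yields a
-- vertex cover A of the graph it induces, a path from its root with D vertices, and one of three
-- certificates: A = ∅; A ⊆ {root} with D ≥ 2; or a W^(m+1) minor whose root branch set contains
-- the root, with 2|A| + 2 ≤ m q + 2D. Seen from x, a star at c becomes a one-legged
-- daddy-longlegs and a daddy-longlegs at c extends its root branch set by x. Gluing two of them
-- at x adds up their legs, and since the paths from x and from c join through x c into a path of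
-- G, their orders satisfy D + D_c ≤ p, which pays for the extra q. At the root, m + 1 ≤ dll(G)
-- and D ≤ p give 2τ(G) ≤ (dll(G) + 1) p. As adjacency is not decidable, the construction runs
-- under double negation, which is harmless because the conclusion is a decidable inequality.
module Submission where

open import Defs
open import Level using (0ℓ)
open import Function using (_∘_)
open import Effect.Monad using (RawMonad)
open import Data.Bool using (Bool; true; false)
open import Data.Empty using (⊥-elim)
open import Data.Nat using (ℕ; zero; suc; _≤_; _<_; _+_; _*_; ⌈_/2⌉; z≤n; s≤s; _≤?_)
open import Data.Nat.Properties hiding (_≟_)
open import Data.Nat.Tactic.RingSolver using (solve-∀)
open import Data.Fin using (Fin; zero; suc; toℕ; splitAt; join; _≟_)
open import Data.Fin.Properties using (join-splitAt)
open import Data.Fin.Subset using (Subset; _∈_; _∉_; _⊆_; _∪_; _∩_; ∁; ⁅_⁆; ∣_∣)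
  renaming (⊥ to ∅; ⊤ to Full)
open import Data.Fin.Subset.Properties
  using (_∈?_; p⊆p∪q; q⊆p∪q; x∈p∪q⁻; x∈p∩q⁺; x∈p∩q⁻; x∈∁p⇒x∉p; x∉p⇒x∈∁p; x∈⁅x⁆; x∈⁅y⁆⇒x≡y;
         ∣⁅x⁆∣≡1; ∣⊥∣≡0; ∈⊤; ∣p∣≤n; p⊂q⇒∣p∣<∣q∣; x∈p⇒∣p-x∣<∣p∣)
open import Data.List using (List; []; _∷_; length; lookup; _ʳ++_)
open import Data.List.Properties using (length-ʳ++)
open import Data.List.Membership.Propositional.Properties using (∈-lookup)
open import Data.List.Relation.Unary.All as All using (All; []; _∷_)
open import Data.List.Relation.Unary.AllPairs using ([]; _∷_)
open import Data.List.Relation.Unary.Linked using (Linked; []; [-]; _∷_)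
open import Data.List.Relation.Unary.Unique.Propositional using (Unique)
open import Data.Vec using (tabulate; []; _∷_)
open import Data.Vec.Properties using (lookup∘tabulate; lookup⇒[]=; []=⇒lookup)
open import Data.Product using (Σ; ∃; _×_; _,_; proj₁; proj₂)
open import Data.Sum using (_⊎_; inj₁; inj₂; [_,_]′) renaming (map to ⊎-map)
open import Relation.Nullary using (¬_; yes; no; does; contradiction)
open import Relation.Nullary.Negation using (¬¬-Monad)
open import Relation.Nullary.Negation.Core using (DoubleNegation)
open import Relation.Nullary.Decidable using (¬¬-excluded-middle; decidable-stable; dec-true; toSum)
open import Relation.Unary using (Pred; Decidable)
open import Relation.Binary.Definitions using (Symmetric)
open import Relation.Binary.PropositionalEquality using (_≡_; _≢_; refl; sym; trans; cong; cong₂; subst)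

open RawMonad (¬¬-Monad {0ℓ}) using (_>>=_; return)

¬¬-decidable : ∀ {m} (P : Pred (Fin m) 0ℓ) → DoubleNegation (Decidable P)
¬¬-decidable {zero}  P = return λ ()
¬¬-decidable {suc m} P = do
  P₀? ← ¬¬-excluded-middle
  P₊? ← ¬¬-decidable (P ∘ suc)
  return λ { zero → P₀? ; (suc i) → P₊? i }

module _ {m} {P : Pred (Fin m) 0ℓ} (P? : Decidable P) where

  toSubset : Subset m
  toSubset = tabulate (does ∘ P?)

  ∈-toSubset⁺ : ∀ {i} → P i → i ∈ toSubset
  ∈-toSubset⁺ {i} p = lookup⇒[]= i _ (trans (lookup∘tabulate _ i) (dec-true (P? i) p))

  ∈-toSubset⁻ : ∀ {i} → i ∈ toSubset → P i
  ∈-toSubset⁻ {i} i∈ with P? i | trans (sym ([]=⇒lookup i∈)) (lookup∘tabulate (does ∘ P?) i)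
  ... | yes p | _  = p
  ... | no _  | ()

∪-least : ∀ {m} {p q r : Subset m} → p ⊆ r → q ⊆ r → p ∪ q ⊆ r
∪-least p⊆r q⊆r x∈ = [ p⊆r , q⊆r ]′ (x∈p∪q⁻ _ _ x∈)

∣p∪q∣≤∣p∣+∣q∣ : ∀ {m} (p q : Subset m) → ∣ p ∪ q ∣ ≤ ∣ p ∣ + ∣ q ∣
∣p∪q∣≤∣p∣+∣q∣ []          []          = z≤n
∣p∪q∣≤∣p∣+∣q∣ (true ∷ p)  (true ∷ q)  = s≤s (≤-trans (∣p∪q∣≤∣p∣+∣q∣ p q) (+-monoʳ-≤ ∣ p ∣ (n≤1+n ∣ q ∣)))
∣p∪q∣≤∣p∣+∣q∣ (true ∷ p)  (false ∷ q) = s≤s (∣p∪q∣≤∣p∣+∣q∣ p q)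
∣p∪q∣≤∣p∣+∣q∣ (false ∷ p) (true ∷ q)  = ≤-trans (s≤s (∣p∪q∣≤∣p∣+∣q∣ p q)) (≤-reflexive (sym (+-suc _ _)))
∣p∪q∣≤∣p∣+∣q∣ (false ∷ p) (false ∷ q) = ∣p∪q∣≤∣p∣+∣q∣ p q

splitAt-injective : ∀ m {n} {i j : Fin (m + n)} → splitAt m i ≡ splitAt m j → i ≡ j
splitAt-injective m {n} {i} {j} e =
  trans (sym (join-splitAt m n i)) (trans (cong (join m n) e) (join-splitAt m n j))

m+m≤n⇒m≤⌈n/2⌉ : ∀ {m n} → m + m ≤ n → m ≤ ⌈ n /2⌉
m+m≤n⇒m≤⌈n/2⌉ {m} m+m≤n = subst (_≤ _) (sym (n≡⌈n+n/2⌉ m)) (⌈n/2⌉-mono m+m≤n)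

module _ {A : Set} where

  lookup-injective : ∀ {xs : List A} → Unique xs → ∀ {i j} → lookup xs i ≡ lookup xs j → i ≡ j
  lookup-injective (_  ∷ _)   {zero}  {zero}  _ = refl
  lookup-injective (x∉ ∷ _)   {zero}  {suc j} e = ⊥-elim (All.lookup x∉ (∈-lookup j) e)
  lookup-injective (x∉ ∷ _)   {suc i} {zero}  e = ⊥-elim (All.lookup x∉ (∈-lookup i) (sym e))
  lookup-injective (_  ∷ uxs) {suc i} {suc j} e = cong suc (lookup-injective uxs e)

  lookup-linked : ∀ {R : A → A → Set} {xs} → Linked R xs →
                  ∀ i j → toℕ j ≡ suc (toℕ i) → R (lookup xs i) (lookup xs j)
  lookup-linked (Rxy ∷ _) zero    (suc zero)    _  = Rxy
  lookup-linked (_ ∷ l)   (suc i) (suc j)       e  = lookup-linked l i j (suc-injective e)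
  lookup-linked (_ ∷ _)   zero    (suc (suc _)) ()
  lookup-linked (_ ∷ _)   _       zero          ()
  lookup-linked [-]       zero    zero          ()

  unique-ʳ++ : ∀ {xs ys : List A} → Unique xs → Unique ys → All (λ a → All (a ≢_) ys) xs →
               Unique (xs ʳ++ ys)
  unique-ʳ++ []         uys _              = uys
  unique-ʳ++ (x∉ ∷ uxs) uys (x∉ys ∷ xs∉ys) = unique-ʳ++ uxs (x∉ys ∷ uys)
    (All.zipWith (λ (a≢x , a∉ys) → a≢x ∷ a∉ys) (All.map (_∘ sym) x∉ , xs∉ys))

  linked-ʳ++ : ∀ {R : A → A → Set} {x xs ys} → Symmetric R →
               Linked R (x ∷ xs) → Linked R (x ∷ ys) → Linked R (xs ʳ++ x ∷ ys)
  linked-ʳ++ R-sym [-]         lys = lys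
  linked-ʳ++ R-sym (Rxy ∷ lxs) lys = linked-ʳ++ R-sym lxs (R-sym Rxy ∷ lys)

module _ {G : Graph} where

  mapʷ : ∀ {P Q : Fin (n G) → Set} {a b} → (∀ {z} → P z → Q z) → WalkIn G P a b → WalkIn G Q a b
  mapʷ f (here p)     = here (f p)
  mapʷ f (step p e w) = step (f p) e (mapʷ f w)

  module _ {P : Fin (n G) → Set} where

    headʷ : ∀ {a b} → WalkIn G P a b → P a
    headʷ (here p)     = p
    headʷ (step p _ _) = p

    _++ʷ_ : ∀ {a b c} → WalkIn G P a b → WalkIn G P b c → WalkIn G P a c
    here _     ++ʷ w′ = w′
    step p e w ++ʷ w′ = step p e (w ++ʷ w′)

    reverseʷ : ∀ {a b} → WalkIn G P a b → WalkIn G P b a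
    reverseʷ (here p)     = here p
    reverseʷ (step p e w) = reverseʷ w ++ʷ step (headʷ w) (E-sym G e) (here p)

  walk-from-⁅⁆ : ∀ {P : Fin (n G) → Set} {x y} → y ∈ ⁅ x ⁆ → P x → WalkIn G P y x
  walk-from-⁅⁆ {x = x} y∈⁅x⁆ Px with x∈⁅y⁆⇒x≡y x y∈⁅x⁆
  ... | refl = here Px

  pathOn : (xs : List (Fin (n G))) → Unique xs → Linked (E G) xs → PathOn G (length xs)
  pathOn xs xs-unique xs-linked =
    record { f = lookup xs ; inj = lookup-injective xs-unique ; adj = lookup-linked xs-linked }

  edge-path : ∀ {x y} → E G x y → PathOn G 2
  edge-path {x} {y} e = pathOn (x ∷ y ∷ []) ((x≢y ∷ []) ∷ [] ∷ []) (e ∷ [-])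
    where
      x≢y : x ≢ y
      x≢y x≡y = E-irr G (subst (E G x) (sym x≡y) e)

  short-paths⇒τ≤0 : ∀ {t} → IsTau G t → (∀ j → PathOn G j → j ≤ 1) → t ≤ 0
  short-paths⇒τ≤0 (_ , τ-min) short = ≤-trans (τ-min ∅ edgeless) (≤-reflexive (∣⊥∣≡0 (n G)))
    where
      edgeless : IsVertexCover G ∅
      edgeless x y e = contradiction (short 2 (edge-path e)) λ { (s≤s ()) }

module _ (G : Graph) where

  private
    V : Set
    V = Fin (n G)

  RootedConnected : Subset (n G) → V → Set
  RootedConnected S x = ∀ {y} → y ∈ S → WalkIn G (_∈ S) y x

  CoversIn : Subset (n G) → Subset (n G) → Set
  CoversIn S A = ∀ {u w} → E G u w → u ∈ S → w ∈ S → u ∈ A ⊎ w ∈ A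

  record PathFrom (S : Subset (n G)) (x : V) : Set where
    field
      rest       : List V
      unique     : Unique (x ∷ rest)
      linked     : Linked (E G) (x ∷ rest)
      vertices∈S : All (_∈ S) (x ∷ rest)

    order : ℕ
    order = suc (length rest)
  open PathFrom

  trivialPath : ∀ {S x} → x ∈ S → PathFrom S x
  trivialPath x∈S = record { rest = [] ; unique = [] ∷ [] ; linked = [-] ; vertices∈S = x∈S ∷ [] }

  weakenPath : ∀ {S S′ x} → S ⊆ S′ → PathFrom S x → PathFrom S′ x
  weakenPath S⊆S′ P = record
    { rest = rest P ; unique = unique P ; linked = linked P ; vertices∈S = All.map S⊆S′ (vertices∈S P) }

  consPath : ∀ {S S₁ x c} → E G x c → x ∈ S → S₁ ⊆ S → x ∉ S₁ → PathFrom S₁ c → PathFrom S x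
  consPath {c = c} xc x∈S S₁⊆S x∉S₁ P = record
    { rest       = c ∷ rest P
    ; unique     = All.map (λ y∈S₁ x≡y → x∉S₁ (subst (_∈ _) (sym x≡y) y∈S₁)) (vertices∈S P) ∷ unique P
    ; linked     = xc ∷ linked P
    ; vertices∈S = x∈S ∷ All.map S₁⊆S (vertices∈S P)
    }

  longerPath : ∀ {S x} (P Q : PathFrom S x) → Σ (PathFrom S x) λ R → order P ≤ order R × order Q ≤ order R
  longerPath P Q with ≤-total (order P) (order Q)
  ... | inj₁ P≤Q = Q , P≤Q , ≤-refl
  ... | inj₂ Q≤P = P , ≤-refl , Q≤P

  joinPaths : ∀ {S₁ S′ c x} → E G c x → (∀ {y} → y ∈ S₁ → y ∉ S′) →
              (P : PathFrom S₁ c) (Q : PathFrom S′ x) → PathOn G (order P + order Q)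
  joinPaths {S′ = S′} {c} {x} cx disjoint P Q =
    subst (PathOn G) (length-ʳ++ (c ∷ rest P))
      (pathOn ((c ∷ rest P) ʳ++ (x ∷ rest Q))
        (unique-ʳ++ (unique P) (unique Q) (All.map separated (vertices∈S P)))
        (linked-ʳ++ (E-sym G) (linked P) (cx ∷ linked Q)))
    where
      separated : ∀ {y} → y ∈ _ → All (y ≢_) (x ∷ rest Q)
      separated y∈S₁ = All.map (λ z∈S′ y≡z → disjoint y∈S₁ (subst (_∈ S′) (sym y≡z) z∈S′)) (vertices∈S Q)

  -- A W^(m) minor with root branch set (the centre) containing x and singleton branch sets
  -- for u_i = leg i true and v_i = leg i false.
  record Longlegs (S : Subset (n G)) (x : V) (I : Set) : Set where
    field
      centre           : Subset (n G)
      root∈centre      : x ∈ centre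
      centre⊆S         : centre ⊆ S
      centre-connected : RootedConnected centre x
      leg              : I → Bool → V
      leg∈S            : ∀ i b → leg i b ∈ S
      leg∉centre       : ∀ i b → leg i b ∉ centre
      leg-injective    : ∀ i b j b′ → leg i b ≡ leg j b′ → i ≡ j × b ≡ b′
      leg-edge         : ∀ i → E G (leg i true) (leg i false)
      leg-attached     : ∀ i → ∃ λ w → w ∈ centre × E G w (leg i true)
  open Longlegs

  weakenLonglegs : ∀ {S S′ x I} → S ⊆ S′ → Longlegs S x I → Longlegs S′ x I
  weakenLonglegs S⊆S′ L = record
    { centre = centre L ; root∈centre = root∈centre L ; centre⊆S = S⊆S′ ∘ centre⊆S L
    ; centre-connected = centre-connected L ; leg = leg L ; leg∈S = λ i b → S⊆S′ (leg∈S L i b)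
    ; leg∉centre = leg∉centre L ; leg-injective = leg-injective L ; leg-edge = leg-edge L
    ; leg-attached = leg-attached L }

  reindexLonglegs : ∀ {S x I J} (f : J → I) → (∀ {j j′} → f j ≡ f j′ → j ≡ j′) →
                    Longlegs S x I → Longlegs S x J
  reindexLonglegs f f-inj L = record
    { centre = centre L ; root∈centre = root∈centre L ; centre⊆S = centre⊆S L
    ; centre-connected = centre-connected L ; leg = leg L ∘ f ; leg∈S = leg∈S L ∘ f
    ; leg∉centre = leg∉centre L ∘ f
    ; leg-injective = λ i b j b′ e → let i≡j , b≡b′ = leg-injective L (f i) b (f j) b′ e in f-inj i≡j , b≡b′
    ; leg-edge = leg-edge L ∘ f ; leg-attached = leg-attached L ∘ f }

  module _ {S₁ S₂ x I J} (L₁ : Longlegs S₁ x I) (L₂ : Longlegs S₂ x J)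
           (meet-at-root : ∀ {y} → y ∈ S₁ → y ∈ S₂ → y ≡ x) where

    private
      leg₁∉S₂ : ∀ i b → leg L₁ i b ∉ S₂
      leg₁∉S₂ i b ∈S₂ = leg∉centre L₁ i b
        (subst (_∈ centre L₁) (sym (meet-at-root (leg∈S L₁ i b) ∈S₂)) (root∈centre L₁))

      leg₂∉S₁ : ∀ j b → leg L₂ j b ∉ S₁
      leg₂∉S₁ j b ∈S₁ = leg∉centre L₂ j b
        (subst (_∈ centre L₂) (sym (meet-at-root ∈S₁ (leg∈S L₂ j b))) (root∈centre L₂))

      leg∪ : I ⊎ J → Bool → V
      leg∪ = [ leg L₁ , leg L₂ ]′

      leg∪∈S : ∀ i b → leg∪ i b ∈ S₁ ∪ S₂
      leg∪∈S (inj₁ i) b = p⊆p∪q S₂ (leg∈S L₁ i b)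
      leg∪∈S (inj₂ j) b = q⊆p∪q S₁ S₂ (leg∈S L₂ j b)

      leg∪∉centre : ∀ i b → leg∪ i b ∉ centre L₁ ∪ centre L₂
      leg∪∉centre (inj₁ i) b ∈C =
        [ leg∉centre L₁ i b , leg₁∉S₂ i b ∘ centre⊆S L₂ ]′ (x∈p∪q⁻ _ _ ∈C)
      leg∪∉centre (inj₂ j) b ∈C =
        [ leg₂∉S₁ j b ∘ centre⊆S L₁ , leg∉centre L₂ j b ]′ (x∈p∪q⁻ _ _ ∈C)

      leg∪-injective : ∀ i b j b′ → leg∪ i b ≡ leg∪ j b′ → i ≡ j × b ≡ b′
      leg∪-injective (inj₁ i) b (inj₁ j) b′ e with leg-injective L₁ i b j b′ e
      ... | refl , b≡b′ = refl , b≡b′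
      leg∪-injective (inj₂ i) b (inj₂ j) b′ e with leg-injective L₂ i b j b′ e
      ... | refl , b≡b′ = refl , b≡b′
      leg∪-injective (inj₁ i) b (inj₂ j) b′ e = ⊥-elim (leg₁∉S₂ i b (subst (_∈ S₂) (sym e) (leg∈S L₂ j b′)))
      leg∪-injective (inj₂ i) b (inj₁ j) b′ e = ⊥-elim (leg₁∉S₂ j b′ (subst (_∈ S₂) e (leg∈S L₂ i b)))

      leg∪-attached : ∀ i → ∃ λ w → w ∈ centre L₁ ∪ centre L₂ × E G w (leg∪ i true)
      leg∪-attached (inj₁ i) = let w , w∈ , e = leg-attached L₁ i in w , p⊆p∪q _ w∈ , e
      leg∪-attached (inj₂ j) = let w , w∈ , e = leg-attached L₂ j in w , q⊆p∪q _ _ w∈ , e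

    unionLonglegs : Longlegs (S₁ ∪ S₂) x (I ⊎ J)
    unionLonglegs = record
      { centre           = centre L₁ ∪ centre L₂
      ; root∈centre      = p⊆p∪q _ (root∈centre L₁)
      ; centre⊆S         = ∪-least (p⊆p∪q S₂ ∘ centre⊆S L₁) (q⊆p∪q S₁ S₂ ∘ centre⊆S L₂)
      ; centre-connected = λ y∈ → [ mapʷ (p⊆p∪q _) ∘ centre-connected L₁
                                  , mapʷ (q⊆p∪q _ _) ∘ centre-connected L₂ ]′ (x∈p∪q⁻ _ _ y∈)
      ; leg              = leg∪
      ; leg∈S            = leg∪∈S
      ; leg∉centre       = leg∪∉centre
      ; leg-injective    = leg∪-injective
      ; leg-edge         = λ { (inj₁ i) → leg-edge L₁ i ; (inj₂ j) → leg-edge L₂ j }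
      ; leg-attached     = leg∪-attached
      }

  rerootLonglegs : ∀ {S c x I} → E G c x → x ∉ S → Longlegs S c I → Longlegs (⁅ x ⁆ ∪ S) x I
  rerootLonglegs {S} {c} {x} cx x∉S L = record
    { centre           = ⁅ x ⁆ ∪ centre L
    ; root∈centre      = x∈⁅x⁆∪
    ; centre⊆S         = ∪-least (p⊆p∪q S) (q⊆p∪q ⁅ x ⁆ S ∘ centre⊆S L)
    ; centre-connected = λ y∈ → [ (λ y∈⁅x⁆ → walk-from-⁅⁆ y∈⁅x⁆ x∈⁅x⁆∪)
                                , (λ y∈C → mapʷ (q⊆p∪q _ _) (centre-connected L y∈C)
                                             ++ʷ step (q⊆p∪q _ _ (root∈centre L)) cx (here x∈⁅x⁆∪)) ]′
                                  (x∈p∪q⁻ _ _ y∈)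
    ; leg              = leg L
    ; leg∈S            = λ i b → q⊆p∪q ⁅ x ⁆ S (leg∈S L i b)
    ; leg∉centre       = λ i b ∈C → [ (λ ∈⁅x⁆ → x∉S (subst (_∈ S) (x∈⁅y⁆⇒x≡y x ∈⁅x⁆) (leg∈S L i b)))
                                    , leg∉centre L i b ]′ (x∈p∪q⁻ _ _ ∈C)
    ; leg-injective    = leg-injective L
    ; leg-edge         = leg-edge L
    ; leg-attached     = λ i → let w , w∈ , e = leg-attached L i in w , q⊆p∪q _ _ w∈ , e
    }
    where
      x∈⁅x⁆∪ : x ∈ ⁅ x ⁆ ∪ centre L
      x∈⁅x⁆∪ = p⊆p∪q _ (x∈⁅x⁆ x)

  singleLeg : ∀ {S x c z} → E G x c → E G c z → c ∈ S → z ∈ S → x ∉ S → Longlegs (⁅ x ⁆ ∪ S) x (Fin 1)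
  singleLeg {S} {x} {c} {z} xc cz c∈S z∈S x∉S = record
    { centre           = ⁅ x ⁆
    ; root∈centre      = x∈⁅x⁆ x
    ; centre⊆S         = p⊆p∪q S
    ; centre-connected = λ y∈ → walk-from-⁅⁆ y∈ (x∈⁅x⁆ x)
    ; leg              = λ _ → knee-foot
    ; leg∈S            = λ _ b → q⊆p∪q ⁅ x ⁆ S (knee-foot∈S b)
    ; leg∉centre       = λ _ b ∈⁅x⁆ → x∉S (subst (_∈ S) (x∈⁅y⁆⇒x≡y x ∈⁅x⁆) (knee-foot∈S b))
    ; leg-injective    = λ { zero b zero b′ e → refl , knee-foot-injective b b′ e }
    ; leg-edge         = λ _ → cz
    ; leg-attached     = λ _ → x , x∈⁅x⁆ x , xc
    }
    where
      knee-foot : Bool → V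
      knee-foot true  = c
      knee-foot false = z

      knee-foot∈S : ∀ b → knee-foot b ∈ S
      knee-foot∈S true  = c∈S
      knee-foot∈S false = z∈S

      knee-foot-injective : ∀ b b′ → knee-foot b ≡ knee-foot b′ → b ≡ b′
      knee-foot-injective true  true  _   = refl
      knee-foot-injective false false _   = refl
      knee-foot-injective true  false c≡z = ⊥-elim (E-irr G (subst (E G c) (sym c≡z) cz))
      knee-foot-injective false true  z≡c = ⊥-elim (E-irr G (subst (E G c) z≡c cz))

  longlegs⇒minor : ∀ {S x m} → Longlegs S x (Fin m) → HasDLLMinor G m
  longlegs⇒minor {x = x} {m} L = record
    { B = B ; nonempty = nonempty ; connected = connected ; disjoint = disjoint ; edges = edges }
    where
      B : DLLVertex m → V → Set
      B r     y = y ∈ centre L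
      B (u i) y = y ≡ leg L i true
      B (v i) y = y ≡ leg L i false

      nonempty : ∀ h → ∃ (B h)
      nonempty r     = x , root∈centre L
      nonempty (u i) = _ , refl
      nonempty (v i) = _ , refl

      connected : ∀ h a b → B h a → B h b → WalkIn G (B h) a b
      connected r     a b a∈ b∈   = centre-connected L a∈ ++ʷ reverseʷ (centre-connected L b∈)
      connected (u i) a b refl refl = here refl
      connected (v i) a b refl refl = here refl

      disjoint : ∀ h h′ y → h ≢ h′ → B h y → B h′ y → _
      disjoint r     r     y h≢h′ _    _ = h≢h′ refl
      disjoint r     (u j) y _    y∈   refl = leg∉centre L j true y∈
      disjoint r     (v j) y _    y∈   refl = leg∉centre L j false y∈
      disjoint (u i) r     y _    refl y∈   = leg∉centre L i true y∈
      disjoint (v i) r     y _    refl y∈   = leg∉centre L i false y∈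
      disjoint (u i) (u j) y h≢h′ refl e with leg-injective L i true j true e
      ... | refl , _ = h≢h′ refl
      disjoint (v i) (v j) y h≢h′ refl e with leg-injective L i false j false e
      ... | refl , _ = h≢h′ refl
      disjoint (u i) (v j) y _    refl e with leg-injective L i true j false e
      ... | _ , ()
      disjoint (v i) (u j) y _    refl e with leg-injective L i false j true e
      ... | _ , ()

      edges : ∀ h h′ → DLLEdge m h h′ → ∃ λ a → ∃ λ b → B h a × B h′ b × E G a b
      edges _ _ (ru i) = let w , w∈ , e = leg-attached L i in w , _ , w∈ , refl , e
      edges _ _ (ur i) = let w , w∈ , e = leg-attached L i in _ , w , refl , w∈ , E-sym G e
      edges _ _ (uv i) = _ , _ , refl , refl , leg-edge L i
      edges _ _ (vu i) = _ , _ , refl , refl , E-sym G (leg-edge L i)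

  record Separation (S S₁ S′ : Subset (n G)) (x c : V) : Set where
    field
      edge           : E G c x
      c∈S₁           : c ∈ S₁
      x∈S′           : x ∈ S′
      x∉S₁           : x ∉ S₁
      S₁⊆S           : S₁ ⊆ S
      S′⊆S           : S′ ⊆ S
      partition      : ∀ {y} → y ∈ S → y ∈ S₁ ⊎ y ∈ S′
      disjoint       : ∀ {y} → y ∈ S₁ → y ∉ S′
      only-through-x : ∀ {u w} → E G u w → u ∈ S₁ → w ∈ S′ → w ≡ x

  module Separate {S x c} (x∈S : x ∈ S) (c∈S : c ∈ S) (xc : E G x c)
                  (reaches? : Decidable (λ y → WalkIn G (λ z → z ∈ S × z ≢ x) y c)) where

    S₁ S′ : Subset (n G)
    S₁ = toSubset reaches?
    S′ = S ∩ ∁ S₁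

    private
      c≢x : c ≢ x
      c≢x c≡x = E-irr G (subst (E G x) c≡x xc)

      x∉S₁ : x ∉ S₁
      x∉S₁ x∈ = proj₂ (headʷ (∈-toSubset⁻ reaches? x∈)) refl

      S₁⊆S : S₁ ⊆ S
      S₁⊆S y∈ = proj₁ (headʷ (∈-toSubset⁻ reaches? y∈))

      S′⊆S : S′ ⊆ S
      S′⊆S y∈ = proj₁ (x∈p∩q⁻ S _ y∈)

      ∈S′ : ∀ {y} → y ∈ S → y ∉ S₁ → y ∈ S′
      ∈S′ y∈S y∉S₁ = x∈p∩q⁺ (y∈S , x∉p⇒x∈∁p y∉S₁)

      disjoint : ∀ {y} → y ∈ S₁ → y ∉ S′
      disjoint y∈S₁ y∈S′ = x∈∁p⇒x∉p (proj₂ (x∈p∩q⁻ S _ y∈S′)) y∈S₁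

      closed : ∀ {u w} → E G u w → u ∈ S₁ → w ∈ S → w ≢ x → w ∈ S₁
      closed e u∈ w∈S w≢x = ∈-toSubset⁺ reaches? (step (w∈S , w≢x) (E-sym G e) (∈-toSubset⁻ reaches? u∈))

      only-through-x : ∀ {u w} → E G u w → u ∈ S₁ → w ∈ S′ → w ≡ x
      only-through-x {w = w′} e u∈ w∈ with w′ ≟ x
      ... | yes w≡x = w≡x
      ... | no  w≢x = ⊥-elim (disjoint (closed e u∈ (S′⊆S w∈) w≢x) w∈)

      into-S₁ : ∀ {y} → WalkIn G (λ z → z ∈ S × z ≢ x) y c → WalkIn G (_∈ S₁) y c
      into-S₁ (here _)         = here (∈-toSubset⁺ reaches? (here (c∈S , c≢x)))
      into-S₁ w@(step _ e w′)  = step (∈-toSubset⁺ reaches? w) e (into-S₁ w′)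

      into-S′ : ∀ {y} → WalkIn G (_∈ S) y x → y ∈ S′ → WalkIn G (_∈ S′) y x
      into-S′ (here _) y∈ = here y∈
      into-S′ {y} (step _ e w) y∈ with y ≟ x
      ... | yes refl = here y∈
      ... | no  y≢x  = step y∈ e (into-S′ w (∈S′ (headʷ w) λ y′∈S₁ →
                         disjoint (closed (E-sym G e) y′∈S₁ (S′⊆S y∈) y≢x) y∈))

    c∈S₁ : c ∈ S₁
    c∈S₁ = ∈-toSubset⁺ reaches? (here (c∈S , c≢x))

    x∈S′ : x ∈ S′
    x∈S′ = ∈S′ x∈S x∉S₁

    separation : Separation S S₁ S′ x c
    separation = record
      { edge = E-sym G xc ; c∈S₁ = c∈S₁ ; x∈S′ = x∈S′ ; x∉S₁ = x∉S₁ ; S₁⊆S = S₁⊆S ; S′⊆S = S′⊆S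
      ; partition = λ {y} y∈S → [ inj₁ , inj₂ ∘ ∈S′ y∈S ]′ (toSum (y ∈? S₁))
      ; disjoint = disjoint ; only-through-x = only-through-x }

    S₁-connected : RootedConnected S₁ c
    S₁-connected y∈ = into-S₁ (∈-toSubset⁻ reaches? y∈)

    S′-connected : RootedConnected S x → RootedConnected S′ x
    S′-connected S-connected y∈ = into-S′ (S-connected (S′⊆S y∈)) y∈

    ∣S₁∣<∣S∣ : ∣ S₁ ∣ < ∣ S ∣
    ∣S₁∣<∣S∣ = p⊂q⇒∣p∣<∣q∣ (S₁⊆S , x , x∈S , x∉S₁)

    ∣S′∣<∣S∣ : ∣ S′ ∣ < ∣ S ∣
    ∣S′∣<∣S∣ = p⊂q⇒∣p∣<∣q∣ (S′⊆S , c , c∈S , disjoint c∈S₁)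

module Budget (q : ℕ) where

  star-budget : ∀ {a D} → a ≤ 1 → 2 ≤ D → a + a + 2 ≤ 0 * q + (D + D)
  star-budget a≤1 2≤D = ≤-trans (+-monoˡ-≤ 2 (+-mono-≤ a≤1 a≤1)) (+-mono-≤ 2≤D 2≤D)

  extend-budget : ∀ {a b} m D → a ≤ suc b → b + b + 2 ≤ m * q + (D + D) →
                  a + a + 2 ≤ m * q + (suc D + suc D)
  extend-budget {a} {b} m D a≤1+b budget = begin
    a + a + 2               ≤⟨ +-monoˡ-≤ 2 (+-mono-≤ a≤1+b a≤1+b) ⟩
    suc b + suc b + 2       ≡⟨ unfold b ⟩
    (b + b + 2) + 2         ≤⟨ +-monoˡ-≤ 2 budget ⟩
    m * q + (D + D) + 2     ≡⟨ fold m q D ⟩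
    m * q + (suc D + suc D) ∎
    where
      open ≤-Reasoning
      unfold : ∀ b → suc b + suc b + 2 ≡ (b + b + 2) + 2
      unfold = solve-∀
      fold : ∀ m q D → m * q + (D + D) + 2 ≡ m * q + (suc D + suc D)
      fold = solve-∀

  merge-budget : ∀ {a} a₁ a₂ m₁ m₂ {D₁ D₂ D} → a ≤ a₁ + a₂ →
                 a₁ + a₁ + 2 ≤ m₁ * q + (D₁ + D₁) → a₂ + a₂ + 2 ≤ m₂ * q + (D₂ + D₂) →
                 D₂ + D₁ ≤ 2 + q → D₁ ≤ D → D₂ ≤ D →
                 a + a + 2 ≤ (m₁ + suc m₂) * q + (D + D)
  merge-budget {a} a₁ a₂ m₁ m₂ {D₁} {D₂} {D} a≤ budget₁ budget₂ joined D₁≤D D₂≤D =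
    +-cancelʳ-≤ 2 _ _ (begin
      a + a + 2 + 2                               ≤⟨ +-monoˡ-≤ 2 (+-monoˡ-≤ 2 (+-mono-≤ a≤ a≤)) ⟩
      (a₁ + a₂) + (a₁ + a₂) + 2 + 2               ≡⟨ split-covers a₁ a₂ ⟩
      (a₁ + a₁ + 2) + (a₂ + a₂ + 2)               ≤⟨ +-mono-≤ budget₁ budget₂ ⟩
      (m₁ * q + (D₁ + D₁)) + (m₂ * q + (D₂ + D₂)) ≡⟨ pair-paths m₁ m₂ q D₁ D₂ ⟩
      m₁ * q + m₂ * q + (D₂ + D₁) + (D₂ + D₁)     ≤⟨ +-mono-≤ (+-monoʳ-≤ (m₁ * q + m₂ * q) joined)
                                                                (+-mono-≤ D₂≤D D₁≤D) ⟩
      m₁ * q + m₂ * q + (2 + q) + (D + D)         ≡⟨ collect m₁ m₂ q D ⟩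
      (m₁ + suc m₂) * q + (D + D) + 2             ∎)
    where
      open ≤-Reasoning
      split-covers : ∀ a₁ a₂ → (a₁ + a₂) + (a₁ + a₂) + 2 + 2 ≡ (a₁ + a₁ + 2) + (a₂ + a₂ + 2)
      split-covers = solve-∀
      pair-paths : ∀ m₁ m₂ q D₁ D₂ →
                   (m₁ * q + (D₁ + D₁)) + (m₂ * q + (D₂ + D₂)) ≡ m₁ * q + m₂ * q + (D₂ + D₁) + (D₂ + D₁)
      pair-paths = solve-∀
      collect : ∀ m₁ m₂ q D → m₁ * q + m₂ * q + (2 + q) + (D + D) ≡ (m₁ + suc m₂) * q + (D + D) + 2
      collect = solve-∀

  root-budget : ∀ a {m k D} → a + a + 2 ≤ m * q + (D + D) → suc m ≤ k → D ≤ 2 + q →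
                a + a ≤ suc k * (2 + q)
  root-budget a {m} {k} {D} budget m<k D≤p = +-cancelʳ-≤ 2 _ _ (begin
    a + a + 2                          ≤⟨ budget ⟩
    m * q + (D + D)                    ≤⟨ +-monoʳ-≤ (m * q) (+-mono-≤ D≤p D≤p) ⟩
    m * q + ((2 + q) + (2 + q))        ≡⟨ collect m q ⟩
    suc (suc m) * q + 2 + 2            ≤⟨ +-monoˡ-≤ 2 (+-monoˡ-≤ 2 (*-monoˡ-≤ q (s≤s m<k))) ⟩
    suc k * q + 2 + 2                  ≤⟨ +-monoˡ-≤ 2 (+-monoʳ-≤ (suc k * q) (m≤m+n 2 (k + k))) ⟩
    suc k * q + (2 + (k + k)) + 2      ≡⟨ factor k q ⟩
    suc k * (2 + q) + 2                ∎)
    where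
      open ≤-Reasoning
      collect : ∀ m q → m * q + ((2 + q) + (2 + q)) ≡ suc (suc m) * q + 2 + 2
      collect = solve-∀
      factor : ∀ k q → suc k * q + (2 + (k + k)) + 2 ≡ suc k * (2 + q) + 2
      factor = solve-∀

module Covering (G : Graph) (q : ℕ) (path-bound : ∀ j → PathOn G j → j ≤ 2 + q) where

  open Budget q
  open PathFrom

  private
    V : Set
    V = Fin (n G)

  order≤2+q : ∀ {S x} (P : PathFrom G S x) → order P ≤ 2 + q
  order≤2+q P = path-bound _ (pathOn (_ ∷ rest P) (unique P) (linked P))

  data Kind (S : Subset (n G)) (x : V) (A : Subset (n G)) (D : ℕ) : Set where
    trivial : ∣ A ∣ ≡ 0 → Kind S x A D
    star    : ∀ {z} → E G x z → z ∈ S → x ∈ A → ∣ A ∣ ≤ 1 → 2 ≤ D → Kind S x A D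
    spider  : ∀ m → Longlegs G S x (Fin (suc m)) → x ∈ A → ∣ A ∣ + ∣ A ∣ + 2 ≤ m * q + (D + D) →
              Kind S x A D

  record Node (S : Subset (n G)) (x : V) : Set where
    field
      cover  : Subset (n G)
      covers : CoversIn G S cover
      path   : PathFrom G S x
      kind   : Kind S x cover (order path)
  open Node

  cover-bound : ∀ {S x} k → (∀ j → HasDLLMinor G j → j ≤ k) → (N : Node S x) →
                ∣ cover N ∣ + ∣ cover N ∣ ≤ suc k * (2 + q)
  cover-bound k dll-max N with kind N
  ... | trivial a≡0                = ≤-trans (≤-reflexive (cong₂ _+_ a≡0 a≡0)) z≤n
  ... | star _ _ _ a≤1 _           = ≤-trans (+-mono-≤ a≤1 a≤1) (s≤s (s≤s z≤n))
  ... | spider m legs _ budget     =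
    root-budget ∣ cover N ∣ budget (dll-max _ (longlegs⇒minor G legs)) (order≤2+q (path N))

  isolatedNode : ∀ {S x} → x ∈ S → RootedConnected G S x → ¬ (∃ λ c → c ∈ S × E G x c) → Node S x
  isolatedNode {S} {x} x∈S S-connected isolated = record
    { cover  = ∅
    ; covers = λ e u∈ w∈ → ⊥-elim (E-irr G (subst (E G x) (only-x w∈) (subst (λ y → E G y _) (only-x u∈) e)))
    ; path   = trivialPath G x∈S
    ; kind   = trivial (∣⊥∣≡0 (n G)) }
    where
      walk-is-trivial : ∀ {y} → WalkIn G (_∈ S) y x → y ≡ x
      walk-is-trivial (here _) = refl
      walk-is-trivial (step {y} y∈ e w) with walk-is-trivial w
      ... | refl = ⊥-elim (isolated (y , y∈ , E-sym G e))

      only-x : ∀ {y} → y ∈ S → y ≡ x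
      only-x y∈ = walk-is-trivial (S-connected y∈)

  module Merge {S S₁ S′ x c} (sep : Separation G S S₁ S′ x c) where

    open Separation sep

    data Lifted (Aᶜ : Subset (n G)) (Dᶜ : ℕ) : Set where
      nothing : ∣ Aᶜ ∣ ≡ 0 → Lifted Aᶜ Dᶜ
      legs    : ∀ m → Longlegs G (⁅ x ⁆ ∪ S₁) x (Fin (suc m)) →
                ∣ Aᶜ ∣ + ∣ Aᶜ ∣ + 2 ≤ m * q + (Dᶜ + Dᶜ) → Lifted Aᶜ Dᶜ

    lift : ∀ {Aᶜ Dᶜ} → Kind S₁ c Aᶜ Dᶜ → Lifted Aᶜ Dᶜ
    lift (trivial a≡0)              = nothing a≡0
    lift (star cz z∈ _ a≤1 2≤D)     =
      legs 0 (singleLeg G (E-sym G edge) cz c∈S₁ z∈ x∉S₁) (star-budget a≤1 2≤D)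
    lift (spider m L _ budget)      = legs m (rerootLonglegs G edge x∉S₁ L) budget

    S′-meets-⁅x⁆∪S₁-at-x : ∀ {y} → y ∈ S′ → y ∈ ⁅ x ⁆ ∪ S₁ → y ≡ x
    S′-meets-⁅x⁆∪S₁-at-x y∈S′ y∈ = [ x∈⁅y⁆⇒x≡y x , (λ y∈S₁ → ⊥-elim (disjoint y∈S₁ y∈S′)) ]′ (x∈p∪q⁻ _ _ y∈)

    ⁅x⁆∪S₁⊆S : ⁅ x ⁆ ∪ S₁ ⊆ S
    ⁅x⁆∪S₁⊆S = ∪-least (λ y∈ → subst (_∈ S) (sym (x∈⁅y⁆⇒x≡y x y∈)) (S′⊆S x∈S′)) S₁⊆S

    covers-merge : ∀ {A′ Aᶜ A} → CoversIn G S′ A′ → CoversIn G S₁ Aᶜ →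
                   x ∈ A → A′ ⊆ A → Aᶜ ⊆ A → CoversIn G S A
    covers-merge cov′ covᶜ x∈A A′⊆A Aᶜ⊆A e u∈S w∈S with partition u∈S | partition w∈S
    ... | inj₁ u∈ | inj₁ w∈ = ⊎-map Aᶜ⊆A Aᶜ⊆A (covᶜ e u∈ w∈)
    ... | inj₂ u∈ | inj₂ w∈ = ⊎-map A′⊆A A′⊆A (cov′ e u∈ w∈)
    ... | inj₁ u∈ | inj₂ w∈ = inj₂ (subst (_∈ _) (sym (only-through-x e u∈ w∈)) x∈A)
    ... | inj₂ u∈ | inj₁ w∈ = inj₁ (subst (_∈ _) (sym (only-through-x (E-sym G e) w∈ u∈)) x∈A)

    module _ (Nᵖ : Node S′ x) (Nᶜ : Node S₁ c) where

      private
        A′ Aᶜ : Subset (n G)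
        A′ = cover Nᵖ
        Aᶜ = cover Nᶜ

        parentPath : PathFrom G S x
        parentPath = weakenPath G S′⊆S (path Nᵖ)

        childPath : PathFrom G S x
        childPath = consPath G (E-sym G edge) (S′⊆S x∈S′) S₁⊆S x∉S₁ (path Nᶜ)

        joined : order (path Nᶜ) + order (path Nᵖ) ≤ 2 + q
        joined = path-bound _ (joinPaths G edge disjoint (path Nᶜ) (path Nᵖ))

        covers∪ : x ∈ A′ → CoversIn G S (A′ ∪ Aᶜ)
        covers∪ x∈A′ = covers-merge (covers Nᵖ) (covers Nᶜ) (p⊆p∪q Aᶜ x∈A′) (p⊆p∪q Aᶜ) (q⊆p∪q A′ Aᶜ)

        covers∪x∪ : CoversIn G S (A′ ∪ (⁅ x ⁆ ∪ Aᶜ))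
        covers∪x∪ = covers-merge (covers Nᵖ) (covers Nᶜ) (q⊆p∪q A′ _ (p⊆p∪q Aᶜ (x∈⁅x⁆ x)))
                                 (p⊆p∪q _) (q⊆p∪q A′ _ ∘ q⊆p∪q ⁅ x ⁆ Aᶜ)

        ∣A′∪x∪Aᶜ∣ : ∣ A′ ∪ (⁅ x ⁆ ∪ Aᶜ) ∣ ≤ ∣ A′ ∣ + suc ∣ Aᶜ ∣
        ∣A′∪x∪Aᶜ∣ = ≤-trans (∣p∪q∣≤∣p∣+∣q∣ A′ _) (+-monoʳ-≤ ∣ A′ ∣
                      (≤-trans (∣p∪q∣≤∣p∣+∣q∣ ⁅ x ⁆ Aᶜ) (≤-reflexive (cong (_+ ∣ Aᶜ ∣) (∣⁅x⁆∣≡1 x)))))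

        ∣A′∪Aᶜ∣≤∣A′∣ : ∣ Aᶜ ∣ ≡ 0 → ∣ A′ ∪ Aᶜ ∣ ≤ ∣ A′ ∣
        ∣A′∪Aᶜ∣≤∣A′∣ aᶜ≡0 =
          ≤-trans (∣p∪q∣≤∣p∣+∣q∣ A′ Aᶜ) (≤-reflexive (trans (cong (∣ A′ ∣ +_) aᶜ≡0) (+-identityʳ _)))

        x∈A′∪x∪Aᶜ : x ∈ A′ ∪ (⁅ x ⁆ ∪ Aᶜ)
        x∈A′∪x∪Aᶜ = q⊆p∪q A′ _ (p⊆p∪q Aᶜ (x∈⁅x⁆ x))

        combine : Kind S′ x A′ (order (path Nᵖ)) → Lifted Aᶜ (order (path Nᶜ)) → Node S x
        combine (trivial a′≡0) (nothing aᶜ≡0) = record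
          { cover = A′ ∪ (⁅ x ⁆ ∪ Aᶜ) ; covers = covers∪x∪
          ; path = consPath G (E-sym G edge) (S′⊆S x∈S′) S₁⊆S x∉S₁ (trivialPath G c∈S₁)
          ; kind = star (E-sym G edge) (S₁⊆S c∈S₁) x∈A′∪x∪Aᶜ
                        (≤-trans ∣A′∪x∪Aᶜ∣ (≤-reflexive (cong₂ (λ a b → a + suc b) a′≡0 aᶜ≡0))) ≤-refl }
        combine (star xz z∈ x∈A′ a′≤1 2≤D) (nothing aᶜ≡0) = record
          { cover = A′ ∪ Aᶜ ; covers = covers∪ x∈A′ ; path = parentPath
          ; kind = star xz (S′⊆S z∈) (p⊆p∪q Aᶜ x∈A′) (≤-trans (∣A′∪Aᶜ∣≤∣A′∣ aᶜ≡0) a′≤1) 2≤D }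
        combine (spider m L x∈A′ budget) (nothing aᶜ≡0) = record
          { cover = A′ ∪ Aᶜ ; covers = covers∪ x∈A′ ; path = parentPath
          ; kind = spider m (weakenLonglegs G S′⊆S L) (p⊆p∪q Aᶜ x∈A′)
                          (≤-trans (+-monoˡ-≤ 2 (+-mono-≤ (∣A′∪Aᶜ∣≤∣A′∣ aᶜ≡0) (∣A′∪Aᶜ∣≤∣A′∣ aᶜ≡0))) budget) }
        combine (trivial a′≡0) (legs m L budget) = record
          { cover = A′ ∪ (⁅ x ⁆ ∪ Aᶜ) ; covers = covers∪x∪ ; path = childPath
          ; kind = spider m (weakenLonglegs G ⁅x⁆∪S₁⊆S L) x∈A′∪x∪Aᶜ
                          (extend-budget m (order (path Nᶜ))
                                         (≤-trans ∣A′∪x∪Aᶜ∣ (≤-reflexive (cong (_+ suc ∣ Aᶜ ∣) a′≡0))) budget) }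
        combine (star _ _ x∈A′ a′≤1 _) (legs m L budget) = record
          { cover = A′ ∪ Aᶜ ; covers = covers∪ x∈A′ ; path = childPath
          ; kind = spider m (weakenLonglegs G ⁅x⁆∪S₁⊆S L) (p⊆p∪q Aᶜ x∈A′)
                          (extend-budget m (order (path Nᶜ))
                                         (≤-trans (∣p∪q∣≤∣p∣+∣q∣ A′ Aᶜ) (+-monoˡ-≤ ∣ Aᶜ ∣ a′≤1)) budget) }
        combine (spider m₀ L₀ x∈A′ budget₀) (legs m L budget) = record
          { cover = A′ ∪ Aᶜ ; covers = covers∪ x∈A′ ; path = proj₁ longer
          ; kind = spider (m₀ + suc m) (weakenLonglegs G (∪-least S′⊆S ⁅x⁆∪S₁⊆S) legs∪) (p⊆p∪q Aᶜ x∈A′)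
                          (merge-budget ∣ A′ ∣ ∣ Aᶜ ∣ m₀ m (∣p∪q∣≤∣p∣+∣q∣ A′ Aᶜ) budget₀ budget joined
                                        (proj₁ (proj₂ longer)) (≤-trans (n≤1+n _) (proj₂ (proj₂ longer)))) }
          where
            longer : Σ (PathFrom G S x) λ R → order parentPath ≤ order R × order childPath ≤ order R
            longer = longerPath G parentPath childPath

            legs∪ : Longlegs G (S′ ∪ (⁅ x ⁆ ∪ S₁)) x (Fin (suc m₀ + suc m))
            legs∪ = reindexLonglegs G (splitAt (suc m₀)) (splitAt-injective (suc m₀))
                      (unionLonglegs G L₀ L S′-meets-⁅x⁆∪S₁-at-x)

      merge : Node S x
      merge = combine (kind Nᵖ) (lift (kind Nᶜ))

  node : ∀ s {S x} → ∣ S ∣ ≤ s → x ∈ S → RootedConnected G S x → DoubleNegation (Node S x)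
  node zero    ∣S∣≤0 x∈S _ = contradiction (≤-trans (x∈p⇒∣p-x∣<∣p∣ x∈S) ∣S∣≤0) λ ()
  node (suc s) {S} {x} ∣S∣≤ x∈S S-connected = do
    yes (c , c∈S , xc) ← ¬¬-excluded-middle {A = ∃ λ c → c ∈ S × E G x c}
      where no isolated → return (isolatedNode x∈S S-connected isolated)
    reaches? ← ¬¬-decidable _
    let open Separate G x∈S c∈S xc reaches?
    Nᶜ ← node s (≤-pred (≤-trans ∣S₁∣<∣S∣ ∣S∣≤)) c∈S₁ S₁-connected
    Nᵖ ← node s (≤-pred (≤-trans ∣S′∣<∣S∣ ∣S∣≤)) x∈S′ (S′-connected S-connected)
    return (Merge.merge separation Nᵖ Nᶜ)

  ¬¬-small-cover : Connected G → Fin (n G) → ∀ k → (∀ j → HasDLLMinor G j → j ≤ k) →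
                   DoubleNegation (∃ λ A → IsVertexCover G A × ∣ A ∣ + ∣ A ∣ ≤ suc k * (2 + q))
  ¬¬-small-cover G-connected root k dll-max =
    node (n G) (∣p∣≤n Full) ∈⊤ (λ {y} _ → mapʷ (λ _ → ∈⊤) (G-connected y root)) >>= λ N →
    return (cover N , (λ _ _ e → covers N e ∈⊤ ∈⊤) , cover-bound k dll-max N)

lemma44 : (G : Graph) → Connected G → (t k p : ℕ) →
          IsTau G t → IsDll G k → IsPathNumber G p →
          t ≤ ⌈ (suc k * p) /2⌉
lemma44 G _ t k zero τ _ (_ , path-max) =
  ≤-trans (short-paths⇒τ≤0 τ (λ j P → ≤-trans (path-max j P) z≤n)) z≤n
lemma44 G _ t k (suc zero) τ _ (_ , path-max) =
  ≤-trans (short-paths⇒τ≤0 τ path-max) z≤n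
lemma44 G G-connected t k (suc (suc q)) (_ , τ-min) (_ , dll-max) (P , path-max) =
  decidable-stable (t ≤? _) do
    A , A-covers , A+A≤ ← Covering.¬¬-small-cover G q path-max G-connected (PathOn.f P zero) k dll-max
    return (≤-trans (τ-min A A-covers) (m+m≤n⇒m≤⌈n/2⌉ A+A≤))
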